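{- Consider any state reached during play of the long trap setting strategy $S$ at a circular table (of any size), and let $B$ be a block of $n \ge 1$ empty seats in that state. Whenever $S$ seats a diner in a seat of $B$, the label of that seat is: (a) $\operatorname{sgn}(n-4) + 1$ if $B$ is inner-facing; (b) $0$ if $B$ is outer-facing; (c) $0$ if $B$ is asymmetric. (d) Consequently, for each block the set of labels of seats of the block in which $S$ may seat a diner is a single label, depending only on the type and length of the block.
   Context: Seating process: at a circular table, seats and napkins alternate (one napkin between each pair of consecutive seats). Diners are seated one at a time in empty seats chosen by the maître d'; each diner takes an available adjacent napkin (uniformly at random if both adjacent napkins are available, the unique one if exactly one is, none otherwise). An empty seat and an available napkin are neighbors if they are adjacent. The long trap setting strategy $S$: (S1) if some available napkin neighbors exactly one empty seat, seat the next diner in that empty seat; (S2) otherwise (every available napkin neighbors zero or two empty seats), if there is an empty seat $X$ three seats away from an occupied seat with the two seats strictly between them both empty, seat the next diner in such an $X$; if there is no such seat, seat the next diner in any empty seat. A block is a maximal run $s_1,\dots,s_n$ of consecutive empty seats, not comprising the whole table, so that it is flanked on both sides by occupied seats; the $n-1$ napkins between consecutive seats of the block are available, while each of the two boundary napkins (between $s_1$ and the occupied seat before it, and between $s_n$ and the occupied seat after it) may be available or taken. The block is inner-facing if both boundary napkins are taken, outer-facing if both are available, and asymmetric if exactly one is available. The distance between two seats of the block is the number of napkins between them (so $s_i$ and $s_j$ have distance $|i-j|$). For an inner- or outer-facing block, the label of a seat is its distance to the nearer of $s_1, s_n$; for an asymmetric block, the label of a seat is its distance to the end seat ($s_1$ or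 $s_n$) adjacent to the available boundary napkin (for $n=1$ the single seat has label $0$). Here $\operatorname{sgn}$ is the sign function. -}

module Defs where

open import Data.Nat using (ℕ; zero; suc; _+_; _*_; _∸_; _<_; _≤_; _⊓_)
open import Data.Nat.DivMod using (_mod_)
open import Data.Fin using (Fin; toℕ; _≟_)
open import Data.Bool using (Bool; true; false; if_then_else_)
open import Data.Maybe using (Maybe; just; nothing)
open import Data.Integer using (ℤ; +_; -[1+_]; +[1+_])
open import Data.Product using (Σ; ∃; _×_)
open import Data.Sum using (_⊎_)
open import Relation.Nullary using (¬_; does)
open import Relation.Binary.PropositionalEquality using (_≡_)

-- Circular table with N seats and N napkins.
-- Seat i (i : Fin N) and napkin j (j : Fin N); napkin j lies between
-- seat j and seat j+1 (mod N).  So seat i has napkins i (right) and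
-- i-1 (left).

fwd : ∀ {N} → Fin N → ℕ → Fin N
fwd {suc m} i k = (toℕ i + k) mod (suc m)

-- i - k (mod N); with N = suc m, k * m ≡ - k (mod N)
back : ∀ {N} → Fin N → ℕ → Fin N
back {suc m} i k = fwd i (k * m)

record State (N : ℕ) : Set where
  constructor mkState
  field
    occupied  : Fin N → Bool
    available : Fin N → Bool
open State public

initial : ∀ {N} → State N
initial = mkState (λ _ → false) (λ _ → true)

Empty : ∀ {N} → State N → Fin N → Set
Empty st i = occupied st i ≡ false

Occupied : ∀ {N} → State N → Fin N → Set
Occupied st i = occupied st i ≡ true

Available : ∀ {N} → State N → Fin N → Set
Available st j = available st j ≡ true

AdjacentSeat : ∀ {N} → Fin N → Fin N → Set
AdjacentSeat j X = (X ≡ j) ⊎ (X ≡ fwd j 1)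

ExactlyOneEmpty : ∀ {N} → State N → Fin N → Set
ExactlyOneEmpty st j =
  (Empty st j × Occupied st (fwd j 1)) ⊎ (Occupied st j × Empty st (fwd j 1))

S1Applies : ∀ {N} → State N → Set
S1Applies st = ∃ λ j → Available st j × ExactlyOneEmpty st j

TrapSeat : ∀ {N} → State N → Fin N → Set
TrapSeat st X = Empty st X × (∃ λ Y → Occupied st Y ×
  (  (X ≡ fwd Y 3 × Empty st (fwd Y 1) × Empty st (fwd Y 2))
   ⊎ (Y ≡ fwd X 3 × Empty st (fwd X 1) × Empty st (fwd X 2))))

data SChoice {N} (st : State N) (X : Fin N) : Set where
  s1  : (j : Fin N) → Available st j → ExactlyOneEmpty st j →
        AdjacentSeat j X → Empty st X → SChoice st X
  s2  : ¬ S1Applies st → TrapSeat st X → SChoice st X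
  s2' : ¬ S1Applies st → ¬ (∃ λ Y → TrapSeat st Y) → Empty st X → SChoice st X

data Takes {N} (st : State N) (X : Fin N) : Maybe (Fin N) → Set where
  takeRight : Available st X → Takes st X (just X)
  takeLeft  : Available st (back X 1) → Takes st X (just (back X 1))
  takeNone  : available st X ≡ false → available st (back X 1) ≡ false →
              Takes st X nothing

update : ∀ {N} → (Fin N → Bool) → Fin N → Bool → Fin N → Bool
update f i b j = if does (j ≟ i) then b else f j

seatDiner : ∀ {N} → State N → Fin N → Maybe (Fin N) → State N
seatDiner st X (just j) = mkState (update (occupied st) X true) (update (available st) j false)
seatDiner st X nothing  = mkState (update (occupied st) X true) (available st)

data Reachable {N} : State N → Set where
  start : Reachable initial
  step  : ∀ {st X mj} → Reachable st → SChoice st X → Takes st X mj →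
          Reachable (seatDiner st X mj)

-- Blocks.  IsBlock st a n : seats a, a+1, …, a+n-1 form a block
-- (s₁ = a, s_n = a+n-1), flanked by occupied seats a-1 and a+n.

record IsBlock {N} (st : State N) (a : Fin N) (n : ℕ) : Set where
  field
    nonEmpty   : 1 ≤ n
    notWhole   : n < N
    allEmpty   : ∀ k → k < n → Empty st (fwd a k)
    leftOcc    : Occupied st (back a 1)
    rightOcc   : Occupied st (fwd a n)

leftBoundary : ∀ {N} → Fin N → ℕ → Fin N
leftBoundary a n = back a 1
rightBoundary : ∀ {N} → Fin N → ℕ → Fin N
rightBoundary a n = fwd a (n ∸ 1)

data BlockType : Set where
  innerFacing outerFacing asymmetric : BlockType

typeOf : Bool → Bool → BlockType
typeOf false false = innerFacing
typeOf true  true  = outerFacing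
typeOf _     _     = asymmetric

blockType : ∀ {N} → State N → Fin N → ℕ → BlockType
blockType st a n = typeOf (available st (leftBoundary a n)) (available st (rightBoundary a n))

-- label of seat s_{k+1} = a + k (distance k from s₁, n-1-k from s_n)
labelOf : Bool → Bool → ℕ → ℕ → ℕ
labelOf true  false n k = k
labelOf false true  n k = n ∸ 1 ∸ k
labelOf _     _     n k = k ⊓ (n ∸ 1 ∸ k)

label : ∀ {N} → State N → Fin N → ℕ → ℕ → ℕ
label st a n k = labelOf (available st (leftBoundary a n)) (available st (rightBoundary a n)) n k

sgn : ℤ → ℤ
sgn (+ zero)   = + 0
sgn +[1+ _ ]   = + 1
sgn -[1+ _ ]   = -[1+ 0 ]

-- Rule (S1) seats a diner only at an end seat of a block whose boundary
-- napkin is still available; such a seat has label 0 and the block is not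
-- inner-facing.  Rule (S2) applies only when no boundary napkin of any block
-- is available, so the block is inner-facing; then a trap seat of the block
-- is the third seat from an end (label 2 ⊓ (n - 3)), and if there is no
-- trap seat at all, every block has length at most 2 and every label is 0.
module Submission where

open import Defs
open import Data.Bool using (true; false)
open import Data.Bool.Properties using (¬-not)
open import Data.Empty using (⊥-elim)
open import Data.Fin using (Fin; toℕ)
open import Data.Fin.Properties using (toℕ-injective; toℕ-fromℕ<; toℕ<n)
open import Data.Integer using (+_; _+_; _-_)
open import Data.Nat using (ℕ; zero; suc; _<_; _∸_; _⊓_; z≤n; s≤s)
import Data.Nat as ℕ
open import Data.Nat.DivMod using (_%_; m%n%n≡m%n; [m+kn]%n≡m%n; m<n⇒m%n≡m; %-distribˡ-+)
open import Data.Nat.Properties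
  using ( +-assoc; +-comm; +-suc; *-suc; ⊓-comm; ⊓-zeroʳ; n∸n≡0; ∸-+-assoc; m+n∸m≡n; m+n∸n≡m
        ; m+n≤o⇒n≤o; +-monoʳ-≤; +-monoˡ-<; m≤m+n; n<1+n; m≤n⇒m<n∨m≡n; m≤n⇒∃[o]m+o≡n)
open import Data.Product using (_×_; ∃; _,_)
open import Data.Sum using (inj₁; inj₂)
open import Relation.Nullary using (¬_)
open import Relation.Binary.PropositionalEquality
  using (_≡_; refl; sym; trans; cong; subst; module ≡-Reasoning)

toℕ-fwd : ∀ {m} (a : Fin (suc m)) k → toℕ (fwd a k) ≡ (toℕ a ℕ.+ k) % suc m
toℕ-fwd a k = toℕ-fromℕ< _

fwd-+ : ∀ {N} (a : Fin N) i j → fwd (fwd a i) j ≡ fwd a (i ℕ.+ j)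
fwd-+ {suc m} a i j = toℕ-injective (begin
  toℕ (fwd (fwd a i) j)                      ≡⟨ toℕ-fwd (fwd a i) j ⟩
  (toℕ (fwd a i) ℕ.+ j) % suc m              ≡⟨ cong (λ z → (z ℕ.+ j) % suc m) (toℕ-fwd a i) ⟩
  (x % suc m ℕ.+ j) % suc m                  ≡⟨ %-distribˡ-+ (x % suc m) j (suc m) ⟩
  (x % suc m % suc m ℕ.+ j % suc m) % suc m  ≡⟨ cong (λ z → (z ℕ.+ j % suc m) % suc m) (m%n%n≡m%n x (suc m)) ⟩
  (x % suc m ℕ.+ j % suc m) % suc m          ≡⟨ sym (%-distribˡ-+ x j (suc m)) ⟩
  (x ℕ.+ j) % suc m                          ≡⟨ cong (_% suc m) (+-assoc (toℕ a) i j) ⟩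
  (toℕ a ℕ.+ (i ℕ.+ j)) % suc m              ≡⟨ sym (toℕ-fwd a (i ℕ.+ j)) ⟩
  toℕ (fwd a (i ℕ.+ j))                      ∎)
  where
  open ≡-Reasoning
  x = toℕ a ℕ.+ i

fwd-+′ : ∀ {N} (a : Fin N) i j → fwd (fwd a i) j ≡ fwd a (j ℕ.+ i)
fwd-+′ a i j = trans (fwd-+ a i j) (cong (fwd a) (+-comm i j))

fwd-multiple : ∀ {m} (a : Fin (suc m)) k → fwd a (k ℕ.* suc m) ≡ a
fwd-multiple {m} a k = toℕ-injective (begin
  toℕ (fwd a (k ℕ.* suc m))           ≡⟨ toℕ-fwd a (k ℕ.* suc m) ⟩
  (toℕ a ℕ.+ k ℕ.* suc m) % suc m     ≡⟨ [m+kn]%n≡m%n (toℕ a) k (suc m) ⟩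
  toℕ a % suc m                       ≡⟨ m<n⇒m%n≡m (toℕ<n a) ⟩
  toℕ a                               ∎)
  where open ≡-Reasoning

fwd-identityʳ : ∀ {N} (a : Fin N) → fwd a 0 ≡ a
fwd-identityʳ {suc m} a = fwd-multiple a 0

back-fwd : ∀ {N} (a : Fin N) k → back (fwd a k) k ≡ a
back-fwd {suc m} a k = begin
  fwd (fwd a k) (k ℕ.* m)     ≡⟨ fwd-+ a k (k ℕ.* m) ⟩
  fwd a (k ℕ.+ k ℕ.* m)       ≡⟨ cong (fwd a) (sym (*-suc k m)) ⟩
  fwd a (k ℕ.* suc m)         ≡⟨ fwd-multiple a k ⟩
  a                           ∎
  where open ≡-Reasoning

fwd-back : ∀ {N} (a : Fin N) k → fwd (back a k) k ≡ a
fwd-back {suc m} a k = begin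
  fwd (fwd a (k ℕ.* m)) k    ≡⟨ fwd-+′ a (k ℕ.* m) k ⟩
  fwd a (k ℕ.+ k ℕ.* m)      ≡⟨ sym (fwd-+ a k (k ℕ.* m)) ⟩
  back (fwd a k) k           ≡⟨ back-fwd a k ⟩
  a                          ∎
  where open ≡-Reasoning

fwd-injective : ∀ {N} {i j : Fin N} d → fwd i d ≡ fwd j d → i ≡ j
fwd-injective {i = i} {j} d e =
  trans (sym (back-fwd i d)) (trans (cong (λ z → back z d) e) (back-fwd j d))

fwd-cancel : ∀ {N} {Y a : Fin N} d j → fwd Y d ≡ fwd a (d ℕ.+ j) → Y ≡ fwd a j
fwd-cancel {a = a} d j e = fwd-injective d (trans e (sym (fwd-+′ a j d)))

fwd-cancel-back : ∀ {N} {Y a : Fin N} j k → fwd Y (j ℕ.+ suc k) ≡ fwd a k → fwd Y j ≡ back a 1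
fwd-cancel-back {Y = Y} {a} j k e = fwd-injective (suc k) (begin
  fwd (fwd Y j) (suc k)         ≡⟨ fwd-+ Y j (suc k) ⟩
  fwd Y (j ℕ.+ suc k)           ≡⟨ e ⟩
  fwd a k                       ≡⟨ cong (λ z → fwd z k) (sym (fwd-back a 1)) ⟩
  fwd (fwd (back a 1) 1) k      ≡⟨ fwd-+ (back a 1) 1 k ⟩
  fwd (back a 1) (suc k)        ∎)
  where open ≡-Reasoning

choiceLabel : BlockType → ℕ → ℕ
choiceLabel innerFacing n = 2 ⊓ (n ∸ 3)
choiceLabel outerFacing _ = 0
choiceLabel asymmetric  _ = 0

2⊓[n∸3]≡sgn[n-4]+1 : ∀ n → + (2 ⊓ (n ∸ 3)) ≡ sgn (+ n - + 4) + + 1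
2⊓[n∸3]≡sgn[n-4]+1 0 = refl
2⊓[n∸3]≡sgn[n-4]+1 1 = refl
2⊓[n∸3]≡sgn[n-4]+1 2 = refl
2⊓[n∸3]≡sgn[n-4]+1 3 = refl
2⊓[n∸3]≡sgn[n-4]+1 4 = refl
2⊓[n∸3]≡sgn[n-4]+1 (suc (suc (suc (suc (suc n))))) = refl

module _ {N} {st : State N} {a : Fin N} where

  left-end-label : ∀ {n} → Available st (back a 1) →
    label st a n 0 ≡ choiceLabel (blockType st a n) n
  left-end-label {n} av rewrite av with available st (fwd a (n ∸ 1))
  ... | true  = refl
  ... | false = refl

  right-end-label : ∀ {k} → Available st (fwd a k) →
    label st a (suc k) k ≡ choiceLabel (blockType st a (suc k)) (suc k)
  right-end-label {k} av rewrite av with available st (back a 1)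
  ... | true  = trans (cong (k ⊓_) (n∸n≡0 k)) (⊓-zeroʳ k)
  ... | false = n∸n≡0 k

  inner-label : ∀ {n k} →
    available st (back a 1) ≡ false → available st (fwd a (n ∸ 1)) ≡ false →
    k ⊓ (n ∸ 1 ∸ k) ≡ 2 ⊓ (n ∸ 3) → label st a n k ≡ choiceLabel (blockType st a n) n
  inner-label l r eq rewrite l | r = eq

  open IsBlock

  empty-occupied : ∀ {x} → Empty st x → ¬ Occupied st x
  empty-occupied e o with trans (sym e) o
  ... | ()

  s1-label : ∀ {n k} → IsBlock st a n → k < n → (j : Fin N) → Available st j →
    ExactlyOneEmpty st j → AdjacentSeat j (fwd a k) →
    label st a n k ≡ choiceLabel (blockType st a n) n
  s1-label {k = k} B k<n _ av (inj₁ (_ , next-occ)) (inj₁ refl) with m≤n⇒m<n∨m≡n k<n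
  ... | inj₁ k+1<n = ⊥-elim (empty-occupied (allEmpty B (suc k) k+1<n)
                       (subst (Occupied st) (fwd-+′ a k 1) next-occ))
  ... | inj₂ refl  = right-end-label av
  s1-label B k<n _ _ (inj₂ (j-occ , _)) (inj₁ refl) =
    ⊥-elim (empty-occupied (allEmpty B _ k<n) j-occ)
  s1-label B k<n _ _ (inj₁ (_ , next-occ)) (inj₂ X≡) =
    ⊥-elim (empty-occupied (subst (Empty st) X≡ (allEmpty B _ k<n)) next-occ)
  s1-label {k = zero} B _ j av (inj₂ (_ , _)) (inj₂ X≡) =
    left-end-label (subst (Available st) j≡back av)
    where
    j≡back : j ≡ back a 1
    j≡back = trans (sym (fwd-identityʳ j)) (fwd-cancel-back 0 0 (sym X≡))
  s1-label {k = suc k} B k+1<n _ _ (inj₂ (j-occ , _)) (inj₂ X≡) =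
    ⊥-elim (empty-occupied (subst (Empty st) (sym (fwd-cancel 1 k (sym X≡)))
                              (allEmpty B k (m+n≤o⇒n≤o 1 k+1<n))) j-occ)

  trap-before-label : ∀ {n k Y} → IsBlock st a n → k < n → Occupied st Y →
    fwd a k ≡ fwd Y 3 → Empty st (fwd Y 1) → Empty st (fwd Y 2) →
    k ⊓ (n ∸ 1 ∸ k) ≡ 2 ⊓ (n ∸ 3)
  trap-before-label {k = 0} B _ _ X≡ _ e2 =
    ⊥-elim (empty-occupied (subst (Empty st) (fwd-cancel-back 2 0 (sym X≡)) e2) (leftOcc B))
  trap-before-label {k = 1} B _ _ X≡ e1 _ =
    ⊥-elim (empty-occupied (subst (Empty st) (fwd-cancel-back 1 1 (sym X≡)) e1) (leftOcc B))
  trap-before-label {n} {k = 2} _ _ _ _ _ _ = cong (2 ⊓_) (∸-+-assoc n 1 2)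
  trap-before-label {k = suc (suc (suc i))} B k<n Y-occ X≡ _ _ =
    ⊥-elim (empty-occupied (subst (Empty st) (sym (fwd-cancel 3 i (sym X≡)))
                              (allEmpty B i (m+n≤o⇒n≤o 3 k<n))) Y-occ)

  after-block-occupied : ∀ {k o} → IsBlock st a (suc k ℕ.+ o) → Occupied st (fwd (fwd a k) (suc o))
  after-block-occupied {k} {o} B =
    subst (Occupied st) (sym (trans (fwd-+ a k (suc o)) (cong (fwd a) (+-suc k o)))) (rightOcc B)

  trap-after-label : ∀ {n k Y} → IsBlock st a n → k < n → Occupied st Y →
    Y ≡ fwd (fwd a k) 3 → Empty st (fwd (fwd a k) 1) → Empty st (fwd (fwd a k) 2) →
    k ⊓ (n ∸ 1 ∸ k) ≡ 2 ⊓ (n ∸ 3)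
  trap-after-label {k = k} B k<n Y-occ Y≡ e1 e2 with m≤n⇒∃[o]m+o≡n k<n
  ... | 0 , refl = ⊥-elim (empty-occupied e1 (after-block-occupied B))
  ... | 1 , refl = ⊥-elim (empty-occupied e2 (after-block-occupied B))
  ... | 2 , refl rewrite m+n∸m≡n k 2 | m+n∸n≡m k 2 = ⊓-comm k 2
  ... | suc (suc (suc i)) , refl =
    ⊥-elim (empty-occupied (subst (Empty st) (trans (sym (fwd-+ a k 3)) (sym Y≡))
                              (allEmpty B (k ℕ.+ 3) (s≤s (+-monoʳ-≤ k (m≤m+n 3 i))))) Y-occ)

  left-boundary-taken : ∀ {n} → IsBlock st a n → ¬ S1Applies st →
    available st (back a 1) ≡ false
  left-boundary-taken B ¬S1 = ¬-not λ av → ¬S1 (back a 1 , av , inj₂ (leftOcc B , first-empty))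
    where
    first-empty : Empty st (fwd (back a 1) 1)
    first-empty = subst (Empty st) (trans (fwd-identityʳ a) (sym (fwd-back a 1)))
                    (allEmpty B 0 (nonEmpty B))

  right-boundary-taken : ∀ {n} → IsBlock st a n → ¬ S1Applies st →
    available st (fwd a (n ∸ 1)) ≡ false
  right-boundary-taken {zero} B _ with () ← nonEmpty B
  right-boundary-taken {suc n} B ¬S1 = ¬-not λ av → ¬S1 (fwd a n , av , inj₁ (last-empty , after-occupied))
    where
    last-empty : Empty st (fwd a n)
    last-empty = allEmpty B n (n<1+n n)
    after-occupied : Occupied st (fwd (fwd a n) 1)
    after-occupied = subst (Occupied st) (sym (fwd-+′ a n 1)) (rightOcc B)

  s2-label : ∀ {n k} → IsBlock st a n → ¬ S1Applies st → k ⊓ (n ∸ 1 ∸ k) ≡ 2 ⊓ (n ∸ 3) →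
    label st a n k ≡ choiceLabel (blockType st a n) n
  s2-label B ¬S1 = inner-label (left-boundary-taken B ¬S1) (right-boundary-taken B ¬S1)

  no-trap-label : ∀ {n k} → IsBlock st a n → k < n → ¬ (∃ λ Y → TrapSeat st Y) →
    k ⊓ (n ∸ 1 ∸ k) ≡ 2 ⊓ (n ∸ 3)
  no-trap-label {1} {0} _ _ _ = refl
  no-trap-label {2} {0} _ _ _ = refl
  no-trap-label {2} {1} _ _ _ = refl
  no-trap-label {1} {suc _} _ (s≤s ()) _
  no-trap-label {2} {suc (suc _)} _ (s≤s (s≤s ())) _
  no-trap-label {suc (suc (suc m))} B _ ¬trap = ⊥-elim (¬trap (fwd a m , trap))
    where
    empty-after : ∀ i → i < 3 → Empty st (fwd (fwd a m) i)
    empty-after i i<3 = subst (Empty st) (sym (fwd-+′ a m i))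
                          (allEmpty B (i ℕ.+ m) (+-monoˡ-< m i<3))
    trap : TrapSeat st (fwd a m)
    trap = allEmpty B m (+-monoˡ-< m {0} (s≤s z≤n)) , fwd a (3 ℕ.+ m) , rightOcc B ,
           inj₂ (sym (fwd-+′ a m 3) , empty-after 1 (s≤s (s≤s z≤n)) , empty-after 2 (n<1+n 2))

  label-of-choice : ∀ {n k} → IsBlock st a n → k < n → SChoice st (fwd a k) →
    label st a n k ≡ choiceLabel (blockType st a n) n
  label-of-choice B k<n (s1 j av one adj _) = s1-label B k<n j av one adj
  label-of-choice B k<n (s2 ¬S1 (_ , Y , Y-occ , inj₁ (X≡ , e1 , e2))) =
    s2-label B ¬S1 (trap-before-label B k<n Y-occ X≡ e1 e2)
  label-of-choice B k<n (s2 ¬S1 (_ , Y , Y-occ , inj₂ (Y≡ , e1 , e2))) =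
    s2-label B ¬S1 (trap-after-label B k<n Y-occ Y≡ e1 e2)
  label-of-choice B k<n (s2' ¬S1 ¬trap _) = s2-label B ¬S1 (no-trap-label B k<n ¬trap)

lemma3p3 :
    (∀ {N} (st : State N) (a : Fin N) (n k : ℕ) →
      Reachable st → IsBlock st a n → k < n → SChoice st (fwd a k) →
        (blockType st a n ≡ innerFacing → + label st a n k ≡ sgn (+ n - + 4) + + 1)
      × (blockType st a n ≡ outerFacing → label st a n k ≡ 0)
      × (blockType st a n ≡ asymmetric → label st a n k ≡ 0))
    × (∃ λ (f : BlockType → ℕ → ℕ) →
        ∀ {N} (st : State N) (a : Fin N) (n k : ℕ) →
          Reachable st → IsBlock st a n → k < n → SChoice st (fwd a k) →
            label st a n k ≡ f (blockType st a n) n)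
lemma3p3 = by-type , choiceLabel , (λ _ _ _ _ _ → label-of-choice)
  where
  by-type : ∀ {N} (st : State N) (a : Fin N) (n k : ℕ) →
    Reachable st → IsBlock st a n → k < n → SChoice st (fwd a k) →
      (blockType st a n ≡ innerFacing → + label st a n k ≡ sgn (+ n - + 4) + + 1)
    × (blockType st a n ≡ outerFacing → label st a n k ≡ 0)
    × (blockType st a n ≡ asymmetric → label st a n k ≡ 0)
  by-type st a n k _ B k<n c = inner , label-by-type , label-by-type
    where
    label-by-type : ∀ {t} → blockType st a n ≡ t → label st a n k ≡ choiceLabel t n
    label-by-type refl = label-of-choice B k<n c
    inner : blockType st a n ≡ innerFacing → + label st a n k ≡ sgn (+ n - + 4) + + 1
    inner t≡ = trans (cong +_ (label-by-type t≡)) (2⊓[n∸3]≡sgn[n-4]+1 n)
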